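{- Let $G \in ER(n,d,\lambda)$, let $m \ge 2$, and let $X = \{x_1,\dots,x_p\}$ with integers $1 \le x_1 < \dots < x_p$. Then $D_m^X(G)$ is edge-regular if and only if there exist integers $\bar d, \bar\lambda$ such that: (1) for all $v \in V(G)$, $\sum_{i=1}^{p} |N^{x_i}(v)| = \bar d$; (2) for all $u,v \in V(G)$ with $u \sim v$ in $G$, $\sum_{i=1}^{p}\sum_{j=1}^{p} |N^{x_i}(u) \cap N^{x_j}(v)| = \bar\lambda$; (3) for all $v,w \in V(G)$ with $w \in \bigcup_{q=1}^{p} N^{x_q}(v)$, $\sum_{i=1}^{p} |N(v) \cap N^{x_i}(w)| + \sum_{j=1}^{p} |N^{x_j}(v) \cap N(w)| + (m-2)\sum_{k=1}^{p}\sum_{l=1}^{p} |N^{x_k}(v) \cap N^{x_l}(w)| = \lambda + (m-1)\bar\lambda$.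
   Context: All graphs are finite and simple. For a vertex $v$ of $G$, $N(v)$ is its neighborhood and, for a positive integer $x$, $N^x(v)$ is the set of vertices at distance exactly $x$ from $v$ in $G$. A graph is edge-regular if it is regular and there is $\lambda \ge 0$ such that every two adjacent vertices have exactly $\lambda$ common neighbors; $ER(n,d,\lambda)$ denotes the set of edge-regular graphs on $n$ vertices, regular of degree $d$, with parameter $\lambda$. For $m \ge 2$ and $X = \{x_1,\dots,x_p\}$ with $1\le x_1<\dots<x_p$, the $(m,X)$-shadow $D_m^X(G)$ is the simple graph whose vertex set is the disjoint union of $m$ copies $G_1,\dots,G_m$ of $G$ (the copy of $u\in V(G)$ in $G_i$ denoted $u_i$), with edges $u_iv_i$ for $1 \le i \le m$ and $uv \in E(G)$, and edges $u_iv_j$ for $i \neq j$ whenever $u \in \bigcup_{k=1}^{p} N^{x_k}(v)$. -}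

module Defs where

open import Data.Nat using (ℕ; zero; suc; _+_; _*_; _∸_; _≤_; _<_)
open import Data.Bool using (Bool; true; false; _∧_; _∨_; not; if_then_else_)
open import Data.Fin using (Fin; remQuot)
open import Data.Fin.Properties using (_≟_)
open import Data.List using (List; length; filter; allFin; map)
open import Data.Bool.ListAction using (any)
open import Data.Nat.ListAction using (sum)
open import Data.Product using (_×_; _,_; ∃-syntax)
open import Relation.Nullary.Decidable using (⌊_⌋)
open import Relation.Binary.PropositionalEquality using (_≡_)

record Graph (n : ℕ) : Set where
  field
    adj    : Fin n → Fin n → Bool
    sym    : ∀ u v → adj u v ≡ adj v u
    irrefl : ∀ u → adj u u ≡ false
open Graph public

∣_∣ₛ : {n : ℕ} → (Fin n → Bool) → ℕ
∣_∣ₛ {n} S = length (filter (λ v → S v ≡? true) (allFin n))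
  where
  open import Data.Bool.Properties using () renaming (_≟_ to _≡?_)

_∩_ : {n : ℕ} → (Fin n → Bool) → (Fin n → Bool) → (Fin n → Bool)
(S ∩ T) v = S v ∧ T v

Nbhd : {n : ℕ} → (Fin n → Fin n → Bool) → Fin n → (Fin n → Bool)
Nbhd a v w = a v w

-- within a k u v : there is a walk from u to v of length at most k,
-- i.e. dist(u,v) ≤ k.
within : {n : ℕ} → (Fin n → Fin n → Bool) → ℕ → Fin n → Fin n → Bool
within {n} a zero    u v = ⌊ u ≟ v ⌋
within {n} a (suc k) u v =
  within a k u v ∨ any (λ w → a u w ∧ within a k w v) (allFin n)

Ndist : {n : ℕ} → Graph n → ℕ → Fin n → (Fin n → Bool)
Ndist G zero    v w = within (adj G) zero v w
Ndist G (suc k) v w = within (adj G) (suc k) v w ∧ not (within (adj G) k v w)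

deg : {N : ℕ} → (Fin N → Fin N → Bool) → Fin N → ℕ
deg a v = ∣ Nbhd a v ∣ₛ

common : {N : ℕ} → (Fin N → Fin N → Bool) → Fin N → Fin N → ℕ
common a u v = ∣ Nbhd a u ∩ Nbhd a v ∣ₛ

-- G ∈ ER(n,d,λ) (n is the vertex count, built into the type).
IsER : {N : ℕ} → (Fin N → Fin N → Bool) → ℕ → ℕ → Set
IsER a d l = (∀ v → deg a v ≡ d) × (∀ u v → a u v ≡ true → common a u v ≡ l)

EdgeRegular : {N : ℕ} → (Fin N → Fin N → Bool) → Set
EdgeRegular a = ∃[ d ] ∃[ l ] IsER a d l

NX : {n p : ℕ} → Graph n → (Fin p → ℕ) → Fin n → (Fin n → Bool)
NX {p = p} G x v w = any (λ k → Ndist G (x k) v w) (allFin p)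

Σ[_] : {p : ℕ} → (Fin p → ℕ) → ℕ
Σ[_] {p} f = sum (map f (allFin p))

-- The (m,X)-shadow D_m^X(G): vertex set Fin (m * n); vertex a corresponds to
-- u_i where remQuot n a = (i , u) (copy i, vertex u).
shadowAdj : {n p : ℕ} → (m : ℕ) → Graph n → (Fin p → ℕ) →
            Fin (m * n) → Fin (m * n) → Bool
shadowAdj {n} m G x a b with remQuot {m} n a | remQuot {m} n b
... | (i , u) | (j , v) =
  if ⌊ i ≟ j ⌋ then adj G u v else NX G x v u

-- A copy u_i of u sees N(u) inside its own copy of G and N^X(u) inside each of
-- the m − 1 others.  Since the x_i are distinct, N^X(u) is the disjoint union of
-- the spheres N^{x_i}(u), so every count in D_m^X(G) splits copy by copy:
-- deg u_i = d + (m − 1)·d̄(u), two adjacent vertices u_i, v_i have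
-- λ + (m − 1)·λ̄(u,v) common neighbours, and u_i, w_j with i ≠ j have the left-hand
-- side of (3).  Conversely, if D_m^X(G) is edge-regular, cancelling the factor
-- m − 1 ≠ 0 makes d̄ and λ̄ constant; if G has no edges, (2) and (3) are vacuous,
-- because x_i ≥ 1 and a vertex with no neighbours has nothing at positive distance.

module Submission where

open import Defs hiding (sym)
open import Data.Nat using (ℕ; zero; suc; NonZero; _+_; _*_; _∸_; _≤_; _<_; s≤s; _≤′_; ≤′-refl; ≤′-step)
open import Data.Nat.Properties
  using (+-assoc; +-cancelˡ-≡; *-cancelˡ-≡; ≤⇒≤′; +-0-commutativeMonoid)
  renaming (<-cmp to <-cmpℕ; <⇒≢ to <⇒≢ℕ)
open import Data.Fin using (Fin; zero; suc; combine; punchIn; punchOut; _↑ˡ_; _↑ʳ_)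
  renaming (_<_ to _<ᶠ_)
open import Data.Fin.Properties
  using ( <-cmp; suc-injective; remQuot-combine; combine-surjective; any?
        ; punchInᵢ≢i; punchIn-injective; punchIn-punchOut)
  renaming (_≟_ to _≟ᶠ_)
open import Data.Bool using (Bool; true; false; _∧_; _∨_; not; if_then_else_)
open import Data.Bool.Properties using (∧-comm; ∧-conicalˡ; ∧-conicalʳ; ∨-zeroʳ; ⇔→≡; T-≡)
  renaming (_≟_ to _≟ᵇ_)
open import Data.Bool.ListAction using (any; or)
open import Data.List using (length; filter; allFin; tabulate)
open import Data.List.Properties using (map-tabulate; map-cong)
open import Data.Nat.ListAction using () renaming (sum to sumˡ)
open import Data.Product using (_×_; _,_; ∃-syntax; map₂)
open import Data.List.Relation.Unary.Any using (satisfied)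
open import Data.List.Relation.Unary.Any.Properties using (any⁺; any⁻)
open import Data.List.Membership.Propositional using (lose)
open import Data.List.Membership.Propositional.Properties using (∈-allFin)
open import Data.Sum using (_⊎_; inj₁; inj₂)
open import Function using (_∘_)
open import Function.Bundles using (_⇔_; mk⇔; Equivalence)
open import Relation.Binary using (tri<; tri≈; tri>)
open import Relation.Binary.PropositionalEquality
  using (_≡_; _≢_; _≗_; refl; sym; trans; cong; cong₂; module ≡-Reasoning)
open import Relation.Nullary using (¬_; contradiction; yes; no)
open import Relation.Nullary.Decidable using (⌊_⌋; isYes≗does; dec-true)

open import Algebra.Properties.CommutativeMonoid.Sum +-0-commutativeMonoid
  using (sum; sum-syntax; sum-cong-≗; sum-replicate-zero; sum-remove; ∑-comm)

open ≡-Reasoning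

𝟙 : Bool → ℕ
𝟙 true  = 1
𝟙 false = 0

sum-tabulate : ∀ {p} (f : Fin p → ℕ) → sumˡ (tabulate f) ≡ sum f
sum-tabulate {zero}  f = refl
sum-tabulate {suc p} f = cong (f zero +_) (sum-tabulate (f ∘ suc))

Σ[]≡sum : ∀ {p} (f : Fin p → ℕ) → Σ[ f ] ≡ sum f
Σ[]≡sum f = trans (cong sumˡ (map-tabulate (λ i → i) f)) (sum-tabulate f)

Σ[]-cong : ∀ {p} {f g : Fin p → ℕ} → f ≗ g → Σ[ f ] ≡ Σ[ g ]
Σ[]-cong {p} f≗g = cong sumˡ (map-cong f≗g (allFin p))

sum-const : ∀ k c → ∑[ i < k ] c ≡ k * c
sum-const zero    c = refl
sum-const (suc k) c = cong (c +_) (sum-const k c)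

sum-allBut₁ : ∀ {m β} (t : Fin m → ℕ) (i : Fin m) →
              (∀ j → j ≢ i → t j ≡ β) → sum t ≡ t i + (m ∸ 1) * β
sum-allBut₁ {suc k} {β} t i t≡β = begin
  sum t                     ≡⟨ sum-remove t ⟩
  t i + sum (t ∘ punchIn i) ≡⟨ cong (t i +_) (sum-cong-≗ (λ j → t≡β (punchIn i j) (punchInᵢ≢i i j))) ⟩
  t i + ∑[ j < k ] β        ≡⟨ cong (t i +_) (sum-const k β) ⟩
  t i + k * β               ∎

sum-allBut₂ : ∀ {m γ} (t : Fin m → ℕ) {i j : Fin m} → i ≢ j →
              (∀ k → k ≢ i → k ≢ j → t k ≡ γ) → sum t ≡ t i + t j + (m ∸ 2) * γ
sum-allBut₂ {suc zero}        t {zero} {zero} i≢j _ = contradiction refl i≢j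
sum-allBut₂ {suc (suc k)} {γ} t {i} {j} i≢j t≡γ = begin
  sum t                                        ≡⟨ sum-remove t ⟩
  t i + sum (t ∘ punchIn i)                    ≡⟨ cong (t i +_) (sum-allBut₁ (t ∘ punchIn i) j′ others) ⟩
  t i + (t (punchIn i j′) + k * γ)             ≡⟨ cong (λ a → t i + (t a + k * γ)) (punchIn-punchOut i≢j) ⟩
  t i + (t j + k * γ)                          ≡⟨ sym (+-assoc (t i) (t j) (k * γ)) ⟩
  t i + t j + k * γ                            ∎
  where
  j′ : Fin (suc k)
  j′ = punchOut i≢j
  others : ∀ l → l ≢ j′ → t (punchIn i l) ≡ γ
  others l l≢j′ = t≡γ (punchIn i l) (punchInᵢ≢i i l) λ eq →
    l≢j′ (punchIn-injective i l j′ (trans eq (sym (punchIn-punchOut i≢j))))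

sum-↑ : ∀ a {b} (f : Fin (a + b) → ℕ) → sum f ≡ sum (f ∘ (_↑ˡ b)) + sum (f ∘ (a ↑ʳ_))
sum-↑ zero    f = refl
sum-↑ (suc a) f = trans (cong (f zero +_) (sum-↑ a (f ∘ suc))) (sym (+-assoc (f zero) _ _))

sum-combine : ∀ m {n} (f : Fin (m * n) → ℕ) → sum f ≡ ∑[ i < m ] ∑[ u < n ] f (combine i u)
sum-combine zero    f = refl
sum-combine (suc m) {n} f =
  trans (sum-↑ n f) (cong (sum (f ∘ (_↑ˡ (m * n))) +_) (sum-combine m (f ∘ (n ↑ʳ_))))

∣∣ₛ≡sum : ∀ {n} (S : Fin n → Bool) → ∣ S ∣ₛ ≡ sum (𝟙 ∘ S)
∣∣ₛ≡sum {n} S = count-tabulate (λ v → v)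
  where
  count-tabulate : ∀ {k} (g : Fin k → Fin n) →
                   length (filter (λ v → S v ≟ᵇ true) (tabulate g)) ≡ sum (𝟙 ∘ S ∘ g)
  count-tabulate {zero}  g = refl
  count-tabulate {suc k} g with S (g zero)
  ... | true  = cong suc (count-tabulate (g ∘ suc))
  ... | false = count-tabulate (g ∘ suc)

∣∣ₛ-cong : ∀ {n} {S T : Fin n → Bool} → S ≗ T → ∣ S ∣ₛ ≡ ∣ T ∣ₛ
∣∣ₛ-cong {S = S} {T} S≗T =
  trans (∣∣ₛ≡sum S) (trans (sum-cong-≗ (cong 𝟙 ∘ S≗T)) (sym (∣∣ₛ≡sum T)))

∣∩∣ₛ-comm : ∀ {n} (S T : Fin n → Bool) → ∣ S ∩ T ∣ₛ ≡ ∣ T ∩ S ∣ₛ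
∣∩∣ₛ-comm S T = ∣∣ₛ-cong (λ v → ∧-comm (S v) (T v))

constant : ∀ {n} (f : Fin n → ℕ) → (∀ u v → f u ≡ f v) → ∃[ c ] ∀ v → f v ≡ c
constant {zero}  f _      = 0 , λ ()
constant {suc n} f f-flat = f zero , λ v → f-flat v zero

+-*-cancelˡ : ∀ a c .{{_ : NonZero c}} {y z} → a + c * y ≡ a + c * z → y ≡ z
+-*-cancelˡ a c {y} {z} eq = *-cancelˡ-≡ y z c (+-cancelˡ-≡ a _ _ eq)

∀-combine : ∀ {m n} {P : Fin (m * n) → Set} → (∀ i u → P (combine i u)) → ∀ a → P a
∀-combine {m} {n} h a with i , u , refl ← combine-surjective {m} {n} a = h i u

∣∣ₛ-combine : ∀ m {n} (S : Fin (m * n) → Bool) → ∣ S ∣ₛ ≡ ∑[ k < m ] ∣ S ∘ combine k ∣ₛ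
∣∣ₛ-combine m {n} S = begin
  ∣ S ∣ₛ                                    ≡⟨ ∣∣ₛ≡sum S ⟩
  sum (𝟙 ∘ S)                               ≡⟨ sum-combine m {n} (𝟙 ∘ S) ⟩
  ∑[ k < m ] sum (𝟙 ∘ S ∘ combine k)        ≡⟨ sum-cong-≗ {m} (λ k → sym (∣∣ₛ≡sum (S ∘ combine k))) ⟩
  ∑[ k < m ] ∣ S ∘ combine k ∣ₛ             ∎

⋃ : ∀ {n p} → (Fin p → Fin n → Bool) → Fin n → Bool
⋃ {p = p} F w = any (λ k → F k w) (allFin p)

Disjoint : ∀ {n p} → (Fin p → Fin n → Bool) → Set
Disjoint F = ∀ {k k′ w} → F k w ≡ true → F k′ w ≡ true → k ≡ k′

𝟙-or-tabulate : ∀ {p} (f : Fin p → Bool) → (∀ {k k′} → f k ≡ true → f k′ ≡ true → k ≡ k′) →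
                𝟙 (or (tabulate f)) ≡ sum (𝟙 ∘ f)
𝟙-or-tabulate {zero}  f _ = refl
𝟙-or-tabulate {suc p} f unique with f zero in f₀
... | true  = cong suc (sym (trans (sum-cong-≗ others-false) (sum-replicate-zero p)))
  where
  others-false : ∀ k → 𝟙 (f (suc k)) ≡ 0
  others-false k with f (suc k) in fₖ
  ... | true  = contradiction (unique f₀ fₖ) λ ()
  ... | false = refl
... | false = 𝟙-or-tabulate (f ∘ suc) (λ fₖ fₖ′ → suc-injective (unique fₖ fₖ′))

∣∩⋃∣ₛ : ∀ {n p} (S : Fin n → Bool) (F : Fin p → Fin n → Bool) → Disjoint F →
        ∣ S ∩ ⋃ F ∣ₛ ≡ Σ[ (λ k → ∣ S ∩ F k ∣ₛ) ]
∣∩⋃∣ₛ {n} {p} S F disjoint = begin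
  ∣ S ∩ ⋃ F ∣ₛ                            ≡⟨ ∣∣ₛ≡sum (S ∩ ⋃ F) ⟩
  ∑[ w < n ] 𝟙 (S w ∧ ⋃ F w)              ≡⟨ sum-cong-≗ pointwise ⟩
  ∑[ w < n ] ∑[ k < p ] 𝟙 (S w ∧ F k w)   ≡⟨ ∑-comm (λ w k → 𝟙 (S w ∧ F k w)) ⟩
  ∑[ k < p ] ∑[ w < n ] 𝟙 (S w ∧ F k w)   ≡⟨ sum-cong-≗ (λ k → sym (∣∣ₛ≡sum (S ∩ F k))) ⟩
  ∑[ k < p ] ∣ S ∩ F k ∣ₛ                 ≡⟨ sym (Σ[]≡sum (λ k → ∣ S ∩ F k ∣ₛ)) ⟩
  Σ[ (λ k → ∣ S ∩ F k ∣ₛ) ]               ∎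
  where
  pointwise : ∀ w → 𝟙 (S w ∧ ⋃ F w) ≡ ∑[ k < p ] 𝟙 (S w ∧ F k w)
  pointwise w with S w
  ... | false = sym (sum-replicate-zero p)
  ... | true  = trans (cong (𝟙 ∘ or) (map-tabulate (λ k → k) (λ k → F k w)))
                      (𝟙-or-tabulate (λ k → F k w) disjoint)

∣⋃∩∣ₛ : ∀ {n p} (F : Fin p → Fin n → Bool) (S : Fin n → Bool) → Disjoint F →
        ∣ ⋃ F ∩ S ∣ₛ ≡ Σ[ (λ k → ∣ F k ∩ S ∣ₛ) ]
∣⋃∩∣ₛ F S disjoint = begin
  ∣ ⋃ F ∩ S ∣ₛ               ≡⟨ ∣∩∣ₛ-comm (⋃ F) S ⟩
  ∣ S ∩ ⋃ F ∣ₛ               ≡⟨ ∣∩⋃∣ₛ S F disjoint ⟩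
  Σ[ (λ k → ∣ S ∩ F k ∣ₛ) ]  ≡⟨ Σ[]-cong (λ k → ∣∩∣ₛ-comm S (F k)) ⟩
  Σ[ (λ k → ∣ F k ∩ S ∣ₛ) ]  ∎

any-allFin⁺ : ∀ {p} (f : Fin p → Bool) k → f k ≡ true → any f (allFin p) ≡ true
any-allFin⁺ f k fₖ = Equivalence.to T-≡ (any⁺ f (lose (∈-allFin k) (Equivalence.from T-≡ fₖ)))

any-allFin⁻ : ∀ {p} (f : Fin p → Bool) → any f (allFin p) ≡ true → ∃[ k ] f k ≡ true
any-allFin⁻ {p} f h = map₂ (Equivalence.to T-≡) (satisfied (any⁻ f (allFin p) (Equivalence.from T-≡ h)))

module Walks {n} (a : Fin n → Fin n → Bool) where

  within-refl : ∀ u → within a 0 u u ≡ true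
  within-refl u = trans (isYes≗does (u ≟ᶠ u)) (dec-true (u ≟ᶠ u) refl)

  within-zero⁻ : ∀ {u v} → within a 0 u v ≡ true → u ≡ v
  within-zero⁻ {u} {v} h with u ≟ᶠ v
  ... | yes u≡v = u≡v

  within-suc : ∀ {k u v} → within a k u v ≡ true → within a (suc k) u v ≡ true
  within-suc {k} {u} {v} h = cong (_∨ any (λ w → a u w ∧ within a k w v) (allFin n)) h

  within-cons : ∀ {k u w v} → a u w ≡ true → within a k w v ≡ true → within a (suc k) u v ≡ true
  within-cons {k} {u} {w} {v} auw wv =
    trans (cong (within a k u v ∨_) (any-allFin⁺ (λ w′ → a u w′ ∧ within a k w′ v) w (cong₂ _∧_ auw wv)))
          (∨-zeroʳ (within a k u v))

  within-suc⁻ : ∀ {k u v} → within a (suc k) u v ≡ true →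
                within a k u v ≡ true ⊎ ∃[ w ] (a u w ≡ true × within a k w v ≡ true)
  within-suc⁻ {k} {u} {v} h with within a k u v
  ... | true  = inj₁ refl
  ... | false with any-allFin⁻ (λ w → a u w ∧ within a k w v) h
  ...   | w , h′ = inj₂ (w , ∧-conicalˡ _ _ h′ , ∧-conicalʳ _ _ h′)

  within-snoc : ∀ {k u w v} → within a k u w ≡ true → a w v ≡ true → within a (suc k) u v ≡ true
  within-snoc {zero} uw wv with refl ← within-zero⁻ uw = within-cons {0} wv (within-refl _)
  within-snoc {suc k} {u} {w} {v} uw wv with within-suc⁻ {k} {u} {w} uw
  ... | inj₁ uw′              = within-suc {suc k} (within-snoc {k} uw′ wv)
  ... | inj₂ (w′ , uw′ , w′w) = within-cons {suc k} uw′ (within-snoc {k} w′w wv)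

  within-mono : ∀ {k k′ u v} → k ≤′ k′ → within a k u v ≡ true → within a k′ u v ≡ true
  within-mono ≤′-refl        h = h
  within-mono (≤′-step {k′} k≤k′) h = within-suc {k′} (within-mono k≤k′ h)

  within-sym : (∀ u v → a u v ≡ a v u) → ∀ k u v → within a k u v ≡ within a k v u
  within-sym a-sym k u v = ⇔→≡ (mk⇔ (reverse k u v) (reverse k v u))
    where
    reverse : ∀ k u v → within a k u v ≡ true → within a k v u ≡ true
    reverse zero    u v uv with refl ← within-zero⁻ uv = uv
    reverse (suc k) u v uv with within-suc⁻ {k} {u} {v} uv
    ... | inj₁ uv′           = within-suc {k} (reverse k u v uv′)
    ... | inj₂ (w , uw , wv) = within-snoc {k} (reverse k w v wv) (trans (a-sym w u) uw)

module Distance {n} (G : Graph n) where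
  open Walks (adj G)

  Ndist⇒within : ∀ k {u v} → Ndist G k u v ≡ true → within (adj G) k u v ≡ true
  Ndist⇒within zero    h = h
  Ndist⇒within (suc k) h = ∧-conicalˡ _ _ h

  Ndist-suc⇒¬within : ∀ {k u v} → Ndist G (suc k) u v ≡ true → ¬ within (adj G) k u v ≡ true
  Ndist-suc⇒¬within h uv = contradiction (trans (sym (cong not uv)) (∧-conicalʳ _ _ h)) λ ()

  Ndist-sym : ∀ k u v → Ndist G k u v ≡ Ndist G k v u
  Ndist-sym zero    u v = within-sym (Graph.sym G) 0 u v
  Ndist-sym (suc k) u v =
    cong₂ (λ b c → b ∧ not c) (within-sym (Graph.sym G) (suc k) u v) (within-sym (Graph.sym G) k u v)

  Ndist-disjoint : ∀ {a b u v} → a < b → Ndist G a u v ≡ true → ¬ Ndist G b u v ≡ true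
  Ndist-disjoint {a} {suc b} (s≤s a≤b) ha hb =
    Ndist-suc⇒¬within {b} hb (within-mono (≤⇒≤′ a≤b) (Ndist⇒within a ha))

  Ndist-unique : ∀ {a b u v} → Ndist G a u v ≡ true → Ndist G b u v ≡ true → a ≡ b
  Ndist-unique {a} {b} ha hb with <-cmpℕ a b
  ... | tri< a<b _ _ = contradiction hb (Ndist-disjoint a<b ha)
  ... | tri≈ _ a≡b _ = a≡b
  ... | tri> _ _ b<a = contradiction ha (Ndist-disjoint b<a hb)

  Ndist⇒adj : ∀ {k u v} → 1 ≤ k → Ndist G k u v ≡ true → ∃[ w ] adj G u w ≡ true
  Ndist⇒adj {suc k} {u} {v} _ h with within-suc⁻ {k} {u} {v} (∧-conicalˡ _ _ h)
  ... | inj₁ uv            = contradiction uv (Ndist-suc⇒¬within {k} h)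
  ... | inj₂ (w , uw , _)  = w , uw

strictlyIncreasing⇒injective : ∀ {p} (x : Fin p → ℕ) → (∀ i j → i <ᶠ j → x i < x j) →
                               ∀ {i j} → x i ≡ x j → i ≡ j
strictlyIncreasing⇒injective x increasing {i} {j} xᵢ≡xⱼ with <-cmp i j
... | tri< i<j _ _ = contradiction xᵢ≡xⱼ (<⇒≢ℕ (increasing i j i<j))
... | tri≈ _ i≡j _ = i≡j
... | tri> _ _ j<i = contradiction (sym xᵢ≡xⱼ) (<⇒≢ℕ (increasing j i j<i))

module Shadow {n p} (G : Graph n) (x : Fin p → ℕ) where
  open Distance G

  degX : Fin n → ℕ
  degX v = Σ[ (λ i → ∣ Ndist G (x i) v ∣ₛ) ]

  commonNX commonXN commonXX : Fin n → Fin n → ℕ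
  commonNX u v = Σ[ (λ i → ∣ Nbhd (adj G) u ∩ Ndist G (x i) v ∣ₛ) ]
  commonXN u v = Σ[ (λ j → ∣ Ndist G (x j) u ∩ Nbhd (adj G) v ∣ₛ) ]
  commonXX u v = Σ[ (λ i → Σ[ (λ j → ∣ Ndist G (x i) u ∩ Ndist G (x j) v ∣ₛ) ]) ]

  NX-sym : ∀ u v → NX G x u v ≡ NX G x v u
  NX-sym u v = cong or (map-cong (λ k → Ndist-sym (x k) u v) (allFin p))

  slice : ∀ {m} → Fin m → Fin n → Fin m → Fin n → Bool
  slice i u k = if ⌊ i ≟ᶠ k ⌋ then Nbhd (adj G) u else NX G x u

  slice-same : ∀ {m} (i : Fin m) u → slice i u i ≡ Nbhd (adj G) u
  slice-same i u with i ≟ᶠ i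
  ... | yes _  = refl
  ... | no i≢i = contradiction refl i≢i

  slice-other : ∀ {m} {i k : Fin m} u → k ≢ i → slice i u k ≡ NX G x u
  slice-other {i = i} {k} u k≢i with i ≟ᶠ k
  ... | yes i≡k = contradiction (sym i≡k) k≢i
  ... | no _    = refl

  shadowAdj-combine : ∀ m (i k : Fin m) u w → shadowAdj m G x (combine i u) (combine k w) ≡ slice i u k w
  shadowAdj-combine m i k u w =
    trans (cong₂ adjacency (remQuot-combine i u) (remQuot-combine k w)) flip-NX
    where
    adjacency : Fin m × Fin n → Fin m × Fin n → Bool
    adjacency (i , u) (k , w) = if ⌊ i ≟ᶠ k ⌋ then adj G u w else NX G x w u

    flip-NX : adjacency (i , u) (k , w) ≡ slice i u k w
    flip-NX with i ≟ᶠ k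
    ... | yes _ = refl
    ... | no _  = NX-sym w u

  shadowAdj-same-copy : ∀ {m} (i : Fin m) u v → shadowAdj m G x (combine i u) (combine i v) ≡ adj G u v
  shadowAdj-same-copy {m} i u v = trans (shadowAdj-combine m i i u v) (cong (λ S → S v) (slice-same i u))

  shadowAdj-other-copy : ∀ {m} {i j : Fin m} → i ≢ j → ∀ u v →
                         shadowAdj m G x (combine i u) (combine j v) ≡ NX G x u v
  shadowAdj-other-copy {m} {i} {j} i≢j u v =
    trans (shadowAdj-combine m i j u v) (cong (λ S → S v) (slice-other u (i≢j ∘ sym)))

  deg-shadow-slices : ∀ m (i : Fin m) u →
                      deg (shadowAdj m G x) (combine i u) ≡ ∑[ k < m ] ∣ slice i u k ∣ₛ
  deg-shadow-slices m i u =
    trans (∣∣ₛ-combine m _) (sum-cong-≗ (λ k → ∣∣ₛ-cong (shadowAdj-combine m i k u)))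

  common-shadow-slices : ∀ m (i j : Fin m) u v →
                         common (shadowAdj m G x) (combine i u) (combine j v)
                         ≡ ∑[ k < m ] ∣ slice i u k ∩ slice j v k ∣ₛ
  common-shadow-slices m i j u v =
    trans (∣∣ₛ-combine m _) (sum-cong-≗ (λ k → ∣∣ₛ-cong (λ w →
      cong₂ _∧_ (shadowAdj-combine m i k u w) (shadowAdj-combine m j k v w))))

  ShadowConditions : ℕ → ℕ → Set
  ShadowConditions l m = ∃[ d̄ ] ∃[ l̄ ]
    ((∀ v → degX v ≡ d̄)
    × (∀ u v → adj G u v ≡ true → commonXX u v ≡ l̄)
    × (∀ v w → NX G x v w ≡ true →
         commonNX v w + commonXN v w + (m ∸ 2) * commonXX v w ≡ l + (m ∸ 1) * l̄))

  module _ (x-injective : ∀ {i j} → x i ≡ x j → i ≡ j) where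

    NX-disjoint : ∀ v → Disjoint (λ k → Ndist G (x k) v)
    NX-disjoint v h h′ = x-injective (Ndist-unique h h′)

    ∣NX∣ : ∀ v → ∣ NX G x v ∣ₛ ≡ degX v
    ∣NX∣ v = ∣∩⋃∣ₛ (λ _ → true) (λ k → Ndist G (x k) v) (NX-disjoint v)

    ∣N∩NX∣ : ∀ u v → ∣ Nbhd (adj G) u ∩ NX G x v ∣ₛ ≡ commonNX u v
    ∣N∩NX∣ u v = ∣∩⋃∣ₛ (Nbhd (adj G) u) (λ k → Ndist G (x k) v) (NX-disjoint v)

    ∣NX∩N∣ : ∀ u v → ∣ NX G x u ∩ Nbhd (adj G) v ∣ₛ ≡ commonXN u v
    ∣NX∩N∣ u v = ∣⋃∩∣ₛ (λ k → Ndist G (x k) u) (Nbhd (adj G) v) (NX-disjoint u)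

    ∣NX∩NX∣ : ∀ u v → ∣ NX G x u ∩ NX G x v ∣ₛ ≡ commonXX u v
    ∣NX∩NX∣ u v = trans (∣⋃∩∣ₛ (λ k → Ndist G (x k) u) (NX G x v) (NX-disjoint u))
                        (Σ[]-cong (λ i → ∣∩⋃∣ₛ (Ndist G (x i) u) (λ k → Ndist G (x k) v) (NX-disjoint v)))

    deg-shadow : ∀ {m} (i : Fin m) u →
                 deg (shadowAdj m G x) (combine i u) ≡ deg (adj G) u + (m ∸ 1) * degX u
    deg-shadow {m} i u = begin
      deg (shadowAdj m G x) (combine i u)   ≡⟨ deg-shadow-slices m i u ⟩
      ∑[ k < m ] ∣ slice i u k ∣ₛ           ≡⟨ sum-allBut₁ _ i other-copy ⟩
      ∣ slice i u i ∣ₛ + (m ∸ 1) * degX u   ≡⟨ cong (λ S → ∣ S ∣ₛ + (m ∸ 1) * degX u) (slice-same i u) ⟩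
      deg (adj G) u + (m ∸ 1) * degX u      ∎
      where
      other-copy : ∀ k → k ≢ i → ∣ slice i u k ∣ₛ ≡ degX u
      other-copy k k≢i = trans (cong ∣_∣ₛ (slice-other u k≢i)) (∣NX∣ u)

    common-shadow-same : ∀ {m} (i : Fin m) u v →
                         common (shadowAdj m G x) (combine i u) (combine i v)
                         ≡ common (adj G) u v + (m ∸ 1) * commonXX u v
    common-shadow-same {m} i u v = begin
      common (shadowAdj m G x) (combine i u) (combine i v)     ≡⟨ common-shadow-slices m i i u v ⟩
      ∑[ k < m ] ∣ slice i u k ∩ slice i v k ∣ₛ                ≡⟨ sum-allBut₁ _ i other-copy ⟩
      ∣ slice i u i ∩ slice i v i ∣ₛ + (m ∸ 1) * commonXX u v  ≡⟨ cong (_+ (m ∸ 1) * commonXX u v) same-copy ⟩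
      common (adj G) u v + (m ∸ 1) * commonXX u v              ∎
      where
      same-copy : ∣ slice i u i ∩ slice i v i ∣ₛ ≡ common (adj G) u v
      same-copy = cong₂ (λ S T → ∣ S ∩ T ∣ₛ) (slice-same i u) (slice-same i v)

      other-copy : ∀ k → k ≢ i → ∣ slice i u k ∩ slice i v k ∣ₛ ≡ commonXX u v
      other-copy k k≢i =
        trans (cong₂ (λ S T → ∣ S ∩ T ∣ₛ) (slice-other u k≢i) (slice-other v k≢i)) (∣NX∩NX∣ u v)

    common-shadow-distinct : ∀ {m} {i j : Fin m} → i ≢ j → ∀ u v →
                             common (shadowAdj m G x) (combine i u) (combine j v)
                             ≡ commonNX u v + commonXN u v + (m ∸ 2) * commonXX u v
    common-shadow-distinct {m} {i} {j} i≢j u v = begin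
      common (shadowAdj m G x) (combine i u) (combine j v)   ≡⟨ common-shadow-slices m i j u v ⟩
      ∑[ k < m ] ∣ slice i u k ∩ slice j v k ∣ₛ              ≡⟨ sum-allBut₂ _ i≢j other-copy ⟩
      ∣ slice i u i ∩ slice j v i ∣ₛ + ∣ slice i u j ∩ slice j v j ∣ₛ + (m ∸ 2) * commonXX u v
        ≡⟨ cong₂ (λ a b → a + b + (m ∸ 2) * commonXX u v) copy-i copy-j ⟩
      commonNX u v + commonXN u v + (m ∸ 2) * commonXX u v   ∎
      where
      copy-i : ∣ slice i u i ∩ slice j v i ∣ₛ ≡ commonNX u v
      copy-i = trans (cong₂ (λ S T → ∣ S ∩ T ∣ₛ) (slice-same i u) (slice-other v i≢j)) (∣N∩NX∣ u v)

      copy-j : ∣ slice i u j ∩ slice j v j ∣ₛ ≡ commonXN u v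
      copy-j = trans (cong₂ (λ S T → ∣ S ∩ T ∣ₛ) (slice-other u (i≢j ∘ sym)) (slice-same j v)) (∣NX∩N∣ u v)

      other-copy : ∀ k → k ≢ i → k ≢ j → ∣ slice i u k ∩ slice j v k ∣ₛ ≡ commonXX u v
      other-copy k k≢i k≢j =
        trans (cong₂ (λ S T → ∣ S ∩ T ∣ₛ) (slice-other u k≢i) (slice-other v k≢j)) (∣NX∩NX∣ u v)

    conditions⇒edgeRegular : ∀ {m d l} → IsER (adj G) d l → ShadowConditions l m →
                             EdgeRegular (shadowAdj m G x)
    conditions⇒edgeRegular {m} {d} {l} (regular , edge-regular) (d̄ , l̄ , degX≡ , commonXX≡ , commonX≡) =
      d + (m ∸ 1) * d̄ , l + (m ∸ 1) * l̄ ,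
      ∀-combine {m} degree , ∀-combine {m} (λ i u → ∀-combine {m} (adjacent i u))
      where
      degree : ∀ i u → deg (shadowAdj m G x) (combine i u) ≡ d + (m ∸ 1) * d̄
      degree i u = trans (deg-shadow i u) (cong₂ (λ a b → a + (m ∸ 1) * b) (regular u) (degX≡ u))

      adjacent : ∀ i u j v → shadowAdj m G x (combine i u) (combine j v) ≡ true →
                 common (shadowAdj m G x) (combine i u) (combine j v) ≡ l + (m ∸ 1) * l̄
      adjacent i u j v e with i ≟ᶠ j
      ... | yes refl = trans (common-shadow-same i u v)
                             (cong₂ (λ a b → a + (m ∸ 1) * b) (edge-regular u v uv) (commonXX≡ u v uv))
        where
        uv : adj G u v ≡ true
        uv = trans (sym (shadowAdj-same-copy i u v)) e
      ... | no i≢j = trans (common-shadow-distinct i≢j u v)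
                           (commonX≡ u v (trans (sym (shadowAdj-other-copy i≢j u v)) e))

    degX-constant : ∀ {m d D} → 2 ≤ m → (∀ v → deg (adj G) v ≡ d) →
                    (∀ a → deg (shadowAdj m G x) a ≡ D) → ∃[ d̄ ] ∀ v → degX v ≡ d̄
    degX-constant {suc (suc m)} {d} {D} (s≤s (s≤s _)) regular regularᴰ =
      constant degX (λ u v → +-*-cancelˡ d (suc m) (trans (degree u) (sym (degree v))))
      where
      degree : ∀ v → d + suc m * degX v ≡ D
      degree v = begin
        d + suc m * degX v                                  ≡⟨ cong (_+ suc m * degX v) (sym (regular v)) ⟩
        deg (adj G) v + suc m * degX v                      ≡⟨ sym (deg-shadow zero v) ⟩
        deg (shadowAdj _ G x) (combine {suc (suc m)} zero v) ≡⟨ regularᴰ _ ⟩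
        D                                                   ∎

    commonX-constant : ∀ {m l Λ} → 2 ≤ m → (∀ i → 1 ≤ x i) →
                       (∀ u v → adj G u v ≡ true → common (adj G) u v ≡ l) →
                       (∀ a b → shadowAdj m G x a b ≡ true → common (shadowAdj m G x) a b ≡ Λ) →
                       ∃[ l̄ ] ((∀ u v → adj G u v ≡ true → commonXX u v ≡ l̄)
                              × (∀ v w → NX G x v w ≡ true →
                                   commonNX v w + commonXN v w + (m ∸ 2) * commonXX v w ≡ l + (m ∸ 1) * l̄))
    commonX-constant {suc (suc m)} {l} {Λ} (s≤s (s≤s _)) x≥1 edge-regular edge-regularᴰ
      with any? (λ u → any? (λ v → adj G u v ≟ᵇ true))
    ... | yes (u₀ , v₀ , u₀v₀) =
      commonXX u₀ v₀ ,
      (λ u v uv → +-*-cancelˡ l (suc m) (trans (on-edges u v uv) (sym (on-edges u₀ v₀ u₀v₀)))) ,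
      (λ v w vw → trans (on-X-pairs v w vw) (sym (on-edges u₀ v₀ u₀v₀)))
      where
      on-edges : ∀ u v → adj G u v ≡ true → l + suc m * commonXX u v ≡ Λ
      on-edges u v uv = begin
        l + suc m * commonXX u v
          ≡⟨ cong (_+ suc m * commonXX u v) (sym (edge-regular u v uv)) ⟩
        common (adj G) u v + suc m * commonXX u v
          ≡⟨ sym (common-shadow-same zero u v) ⟩
        common (shadowAdj _ G x) (combine {suc (suc m)} zero u) (combine {suc (suc m)} zero v)
          ≡⟨ edge-regularᴰ _ _ (trans (shadowAdj-same-copy zero u v) uv) ⟩
        Λ ∎

      on-X-pairs : ∀ v w → NX G x v w ≡ true → commonNX v w + commonXN v w + m * commonXX v w ≡ Λ
      on-X-pairs v w vw = trans (sym (common-shadow-distinct 0≢1 v w))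
                                (edge-regularᴰ _ _ (trans (shadowAdj-other-copy 0≢1 v w) vw))
        where
        0≢1 : zero ≢ suc zero
        0≢1 ()
    ... | no no-edge =
      0 , (λ u v uv → contradiction (u , v , uv) no-edge) ,
      (λ v w vw → contradiction (v , NX⇒adj vw) no-edge)
      where
      NX⇒adj : ∀ {v w} → NX G x v w ≡ true → ∃[ u ] adj G v u ≡ true
      NX⇒adj vw with k , h ← any-allFin⁻ _ vw = Ndist⇒adj (x≥1 k) h

    edgeRegular⇒conditions : ∀ {m d l} → IsER (adj G) d l → 2 ≤ m → (∀ i → 1 ≤ x i) →
                             EdgeRegular (shadowAdj m G x) → ShadowConditions l m
    edgeRegular⇒conditions (regular , edge-regular) 2≤m x≥1 (_ , _ , regularᴰ , edge-regularᴰ)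
      with d̄ , degX≡ ← degX-constant 2≤m regular regularᴰ
         | l̄ , commonXX≡ , commonX≡ ← commonX-constant 2≤m x≥1 edge-regular edge-regularᴰ
      = d̄ , l̄ , degX≡ , commonXX≡ , commonX≡

theorem3p2 : (n d l : ℕ) (G : Graph n) → IsER (adj G) d l →
    (m : ℕ) → 2 ≤ m →
    (p : ℕ) (x : Fin p → ℕ) → (∀ i → 1 ≤ x i) → (∀ i j → i <ᶠ j → x i < x j) →
    EdgeRegular (shadowAdj m G x) ⇔
      (∃[ d̄ ] ∃[ l̄ ]
        ((∀ v → Σ[ (λ i → ∣ Ndist G (x i) v ∣ₛ) ] ≡ d̄)
        × (∀ u v → adj G u v ≡ true →
             Σ[ (λ i → Σ[ (λ j → ∣ Ndist G (x i) u ∩ Ndist G (x j) v ∣ₛ) ]) ] ≡ l̄)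
        × (∀ v w → NX G x v w ≡ true →
             Σ[ (λ i → ∣ Nbhd (adj G) v ∩ Ndist G (x i) w ∣ₛ) ]
             + Σ[ (λ j → ∣ Ndist G (x j) v ∩ Nbhd (adj G) w ∣ₛ) ]
             + (m ∸ 2) * Σ[ (λ k → Σ[ (λ k' → ∣ Ndist G (x k) v ∩ Ndist G (x k') w ∣ₛ) ]) ]
             ≡ l + (m ∸ 1) * l̄)))
theorem3p2 n d l G isER m 2≤m p x x≥1 increasing =
  mk⇔ (edgeRegular⇒conditions x-injective isER 2≤m x≥1) (conditions⇒edgeRegular x-injective isER)
  where
  open Shadow G x
  x-injective : ∀ {i j} → x i ≡ x j → i ≡ j
  x-injective = strictlyIncreasing⇒injective x increasing
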